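{- For any integer $t\ge 2$, we have $F(r,t)\ge \binom{(tr-2)/2}{r-1}\cdot 2^{r-1}$ for every even integer $r\ge 2$, and $F(r,t)\ge \binom{(tr-t-2)/2}{r-2}\cdot 2^{r-2}$ for every odd integer $r\ge 3$.
   Context: An $r$-uniform hypergraph is a hypergraph all of whose edges have exactly $r$ vertices. A matching is a collection of pairwise disjoint edges; its size is the number of edges. Given matchings $M_1,\dots,M_N$ in the same hypergraph, a rainbow matching of size $t$ consists of pairwise disjoint edges $e_1\in M_{i_1},\dots,e_t\in M_{i_t}$ with distinct indices $i_1,\dots,i_t\in\{1,\dots,N\}$. $F(r,t)$ denotes the maximum possible number $N$ of matchings $M_1,\dots,M_N$ of size $t$ in some $r$-uniform hypergraph such that there is no rainbow matching of size $t$. -}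

module Defs where

open import Data.Nat using (ℕ)
open import Data.Fin using (Fin)
open import Data.Fin.Subset using (Subset; _∩_; ∣_∣; Empty)
open import Data.Product using (Σ; _×_)
open import Relation.Nullary using (¬_)
open import Relation.Binary.PropositionalEquality using (_≡_; _≢_)
open import Function.Definitions using (Injective)

Disjoint : ∀ {n} → Subset n → Subset n → Set
Disjoint p q = Empty (p ∩ q)

IsMatching : (r t : ℕ) {n : ℕ} → (Fin t → Subset n) → Set
IsMatching r t M = (∀ i → ∣ M i ∣ ≡ r) × (∀ i j → i ≢ j → Disjoint (M i) (M j))

HasRainbowMatching : (t : ℕ) {n N : ℕ} → (Fin N → Fin t → Subset n) → Set
HasRainbowMatching t {n} {N} M =
  Σ (Fin t → Fin N) λ σ → Injective _≡_ _≡_ σ ×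
    Σ (Fin t → Fin t) λ c →
      ∀ k l → k ≢ l → Disjoint (M (σ k) (c k)) (M (σ l) (c l))

-- "F(r,t) ≥ N": there are N matchings of size t in some r-uniform hypergraph
-- with no rainbow matching of size t.
F≥ : (r t N : ℕ) → Set
F≥ r t N = Σ ℕ λ n → Σ (Fin N → Fin t → Subset n) λ M →
  (∀ i → IsMatching r t (M i)) × ¬ HasRainbowMatching t M

module Submission where

-- Colours are 0, 1 (special) and j + 2.  The vertices are padding vertices and pairs of
-- vertices, and each matching is the partition into colour classes of a colouring.  In a
-- matching every pair is either split, one half in edge 0 and one in edge 1, or lies in a
-- single edge j + 2; the matchings are all arrangements with exactly k split pairs among k + U,
-- the unsplit pairs being coloured in a fixed order, so there are C(k + U, k) 2^k of them.  One
-- further pair, split in every matching, provides a special vertex of each special colour.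
--
-- A rainbow matching of size t covers all t r vertices.  Let a and b be its edges through the
-- special vertices.  If the matching of a splits a pair, the half missed by a is covered by an
-- edge which cannot contain the whole pair (it would meet a), so it is b, split the same way.
-- By symmetry the matchings of a and b split the same pairs alike, hence coincide; so a = b,
-- although their colours 0 and 1 differ.

open import Defs
open import Data.Nat using (ℕ; zero; suc; _≤_; _+_; _*_; _∸_; _^_; z≤n; s≤s)
open import Data.Nat.DivMod using (_/_; _%_; m≡m%n+[m/n]*n; m*n/n≡m)
open import Data.Nat.Combinatorics using (_C_; nCn≡1; nCk+nC[k+1]≡[n+1]C[k+1])
open import Data.Nat.Properties
  using (+-0-commutativeMonoid; +-commutativeSemigroup; suc-injective; +-assoc; +-suc;
         +-identityʳ; *-identityˡ; *-identityʳ; *-zeroʳ; *-suc; *-distribˡ-+; m+n∸m≡n)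
open import Data.Nat.Solver using (module +-*-Solver)
open import Data.Bool using (Bool; true; false; not; _xor_)
open import Data.Bool.Properties using (not-involutive; not-¬; ¬-not)
open import Data.Fin using (Fin; zero; suc; splitAt; _↑ˡ_; _↑ʳ_; quotient; _≟_)
import Data.Fin.Properties as Fin
open import Data.Fin.Subset using (Subset; _∈_; _∪_; ⋃; ∣_∣; inside; outside)
open import Data.Fin.Subset.Properties
  using (drop-∷-Empty; x∈p∩q⁺; x∈p∩q⁻; x∈p∪q⁻; ∈⊤; ∉⊥; ∣p∣≡n⇒p≡⊤; ∣⊥∣≡0)
import Data.List as List
open import Data.Maybe using (Maybe; just; nothing)
open import Data.Product using (∃; _×_; _,_; proj₁; proj₂)
import Data.Product as Product
open import Data.Sum using (_⊎_; inj₁; inj₂; [_,_]′)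
import Data.Sum as Sum
open import Data.Vec using ([]; tabulate; here)
import Data.Vec as Vec
open import Data.Vec.Properties using (lookup∘tabulate; []=⇒lookup; lookup⇒[]=)
open import Data.Vec.Functional using (Vector; _∷_; _++_; map)
open import Data.Vec.Functional.Properties using (lookup-++ˡ; lookup-++ʳ)
open import Data.Vec.Functional.Relation.Unary.All using (All)
import Data.Vec.Functional.Relation.Unary.All.Properties as All
open import Function using (id; _∘_; _∘′_; case_of_)
open import Function.Definitions using (Injective)
open import Relation.Binary using (Rel; Symmetric)
open import Relation.Nullary using (¬_; does; yes; no; contradiction)
open import Relation.Nullary.Decidable using (dec-true)
open import Relation.Binary.PropositionalEquality

open import Algebra.Properties.CommutativeMonoid.Sum +-0-commutativeMonoid using (sum; ∑-distrib-+; sum-cong-≗)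
open import Algebra.Properties.CommutativeSemigroup +-commutativeSemigroup using (interchange)

𝟙 : Bool → ℕ
𝟙 true  = 1
𝟙 false = 0

δ : ∀ {t} → Fin t → Fin t → ℕ
δ c d = 𝟙 (does (c ≟ d))

∑-const : ∀ n c → sum {n} (λ _ → c) ≡ n * c
∑-const zero    c = refl
∑-const (suc n) c = cong (c +_) (∑-const n c)

∑-splitAt : ∀ m {n} (F : Fin m ⊎ Fin n → ℕ) →
  sum (λ v → F (splitAt m v)) ≡ sum (F ∘′ inj₁) + sum (F ∘′ inj₂)
∑-splitAt zero    F = refl
∑-splitAt (suc m) F = begin
  F (inj₁ zero) + sum (λ v → F (Sum.map₁ suc (splitAt m v)))
    ≡⟨ cong (F (inj₁ zero) +_) (∑-splitAt m (F ∘′ Sum.map₁ suc)) ⟩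
  F (inj₁ zero) + (sum (λ i → F (inj₁ (suc i))) + sum (F ∘′ inj₂))
    ≡⟨ +-assoc (F (inj₁ zero)) _ _ ⟨
  F (inj₁ zero) + sum (λ i → F (inj₁ (suc i))) + sum (F ∘′ inj₂) ∎
  where open ≡-Reasoning

colourCount : ∀ {n t} → (Fin n → Fin t) → Fin t → ℕ
colourCount χ c = sum (λ v → δ (χ v) c)

colourCount-++ : ∀ {m n t} (χ₁ : Fin m → Fin t) (χ₂ : Fin n → Fin t) c →
  colourCount (χ₁ ++ χ₂) c ≡ colourCount χ₁ c + colourCount χ₂ c
colourCount-++ {m} χ₁ χ₂ c = ∑-splitAt m (λ x → δ ([ χ₁ , χ₂ ]′ x) c)

quotient≗zero++suc∘quotient : ∀ m n → quotient {suc m} n ≗ (λ (_ : Fin n) → zero) ++ (suc ∘′ quotient {m} n)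
quotient≗zero++suc∘quotient m n u with splitAt n u
... | inj₁ _ = refl
... | inj₂ _ = refl

colourCount-quotient : ∀ m n (j : Fin m) → colourCount (quotient {m} n) j ≡ n
colourCount-quotient (suc m) n j = begin
  colourCount (quotient n) j
    ≡⟨ sum-cong-≗ (λ u → cong (λ c → δ c j) (quotient≗zero++suc∘quotient m n u)) ⟩
  colourCount (first ++ rest) j
    ≡⟨ colourCount-++ first rest j ⟩
  colourCount first j + colourCount rest j
    ≡⟨ counts j ⟩
  n ∎
  where
  open ≡-Reasoning
  first : Fin n → Fin (suc m)
  first _ = zero
  rest : Fin (m * n) → Fin (suc m)
  rest = suc ∘′ quotient n
  counts : ∀ j → colourCount first j + colourCount rest j ≡ n
  counts zero    = trans (cong₂ _+_ (∑-const n 1) (∑-const (m * n) 0))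
                         (trans (cong₂ _+_ (*-identityʳ n) (*-zeroʳ (m * n))) (+-identityʳ n))
  counts (suc j) = trans (cong₂ _+_ (∑-const n 0) (colourCount-quotient m n j)) (cong (_+ n) (*-zeroʳ n))

∣tabulate∣ : ∀ {n} (b : Fin n → Bool) → ∣ tabulate b ∣ ≡ sum (λ v → 𝟙 (b v))
∣tabulate∣ {zero}  b = refl
∣tabulate∣ {suc n} b with b zero
... | true  = cong suc (∣tabulate∣ (b ∘′ suc))
... | false = ∣tabulate∣ (b ∘′ suc)

∈-tabulate⁻ : ∀ {n} (b : Fin n → Bool) {v} → v ∈ tabulate b → b v ≡ true
∈-tabulate⁻ b {v} v∈ = trans (sym (lookup∘tabulate b v)) ([]=⇒lookup v∈)

∈-tabulate⁺ : ∀ {n} (b : Fin n → Bool) {v} → b v ≡ true → v ∈ tabulate b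
∈-tabulate⁺ b {v} bv = lookup⇒[]= v (tabulate b) (trans (lookup∘tabulate b v) bv)

colourClass : ∀ {n t} → (Fin n → Fin t) → Fin t → Subset n
colourClass χ c = tabulate (λ v → does (χ v ≟ c))

∈-colourClass⁺ : ∀ {n t} (χ : Fin n → Fin t) {c v} → χ v ≡ c → v ∈ colourClass χ c
∈-colourClass⁺ χ {c} {v} χv≡c = ∈-tabulate⁺ _ (dec-true (χ v ≟ c) χv≡c)

∈-colourClass⁻ : ∀ {n t} (χ : Fin n → Fin t) {c v} → v ∈ colourClass χ c → χ v ≡ c
∈-colourClass⁻ χ {c} {v} v∈ with χ v ≟ c | ∈-tabulate⁻ (λ v → does (χ v ≟ c)) v∈
... | yes χv≡c | _ = χv≡c

PairwiseDisjoint : ∀ {t n} → (Fin t → Subset n) → Set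
PairwiseDisjoint E = ∀ k l → k ≢ l → Disjoint (E k) (E l)

colourClass-isMatching : ∀ {n t r} (χ : Fin n → Fin t) →
  (∀ c → colourCount χ c ≡ r) → IsMatching r t (colourClass χ)
colourClass-isMatching χ size = (λ c → trans (∣tabulate∣ (λ v → does (χ v ≟ c))) (size c)) , disjoint
  where
  disjoint : PairwiseDisjoint (colourClass χ)
  disjoint c d c≢d (v , v∈∩) with x∈p∩q⁻ (colourClass χ c) _ v∈∩
  ... | v∈c , v∈d = c≢d (trans (sym (∈-colourClass⁻ χ v∈c)) (∈-colourClass⁻ χ v∈d))

∣p∪q∣≡∣p∣+∣q∣ : ∀ {n} (p q : Subset n) → Disjoint p q → ∣ p ∪ q ∣ ≡ ∣ p ∣ + ∣ q ∣
∣p∪q∣≡∣p∣+∣q∣ []                []                _   = refl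
∣p∪q∣≡∣p∣+∣q∣ (inside  Vec.∷ p) (inside  Vec.∷ q) p#q = contradiction (zero , here) p#q
∣p∪q∣≡∣p∣+∣q∣ (inside  Vec.∷ p) (outside Vec.∷ q) p#q = cong suc (∣p∪q∣≡∣p∣+∣q∣ p q (drop-∷-Empty p#q))
∣p∪q∣≡∣p∣+∣q∣ (outside Vec.∷ p) (inside  Vec.∷ q) p#q =
  trans (cong suc (∣p∪q∣≡∣p∣+∣q∣ p q (drop-∷-Empty p#q))) (sym (+-suc ∣ p ∣ ∣ q ∣))
∣p∪q∣≡∣p∣+∣q∣ (outside Vec.∷ p) (outside Vec.∷ q) p#q = ∣p∪q∣≡∣p∣+∣q∣ p q (drop-∷-Empty p#q)

∈⋃⁻ : ∀ {t n} (E : Fin t → Subset n) {v} → v ∈ ⋃ (List.tabulate E) → ∃ λ k → v ∈ E k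
∈⋃⁻ {zero}  E v∈ = contradiction v∈ ∉⊥
∈⋃⁻ {suc t} E v∈ with x∈p∪q⁻ (E zero) (⋃ (List.tabulate (E ∘′ suc))) v∈
... | inj₁ v∈E₀ = zero , v∈E₀
... | inj₂ v∈⋃ = Product.map suc id (∈⋃⁻ (E ∘′ suc) v∈⋃)

∣⋃∣≡t*r : ∀ {t n r} (E : Fin t → Subset n) → PairwiseDisjoint E → (∀ k → ∣ E k ∣ ≡ r) →
  ∣ ⋃ (List.tabulate E) ∣ ≡ t * r
∣⋃∣≡t*r {zero}  {n} E _ _ = ∣⊥∣≡0 n
∣⋃∣≡t*r {suc t} E disjoint size = begin
  ∣ E zero ∪ ⋃ (List.tabulate (E ∘′ suc)) ∣
    ≡⟨ ∣p∪q∣≡∣p∣+∣q∣ (E zero) _ E₀#⋃ ⟩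
  ∣ E zero ∣ + ∣ ⋃ (List.tabulate (E ∘′ suc)) ∣
    ≡⟨ cong₂ _+_ (size zero) (∣⋃∣≡t*r (E ∘′ suc) disjoint′ (size ∘ suc)) ⟩
  _ + t * _ ∎
  where
  open ≡-Reasoning
  disjoint′ : PairwiseDisjoint (E ∘′ suc)
  disjoint′ k l k≢l = disjoint (suc k) (suc l) (k≢l ∘′ Fin.suc-injective)
  E₀#⋃ : Disjoint (E zero) (⋃ (List.tabulate (E ∘′ suc)))
  E₀#⋃ (v , v∈∩) with x∈p∩q⁻ (E zero) _ v∈∩
  ... | v∈E₀ , v∈⋃ with ∈⋃⁻ (E ∘′ suc) v∈⋃
  ... | k , v∈Eₖ = disjoint zero (suc k) (λ ()) (v , x∈p∩q⁺ (v∈E₀ , v∈Eₖ))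

⋃-covers : ∀ {t n r} (E : Fin t → Subset n) → PairwiseDisjoint E → (∀ k → ∣ E k ∣ ≡ r) →
  n ≡ t * r → ∀ v → ∃ λ k → v ∈ E k
⋃-covers E disjoint size n≡t*r v = ∈⋃⁻ E (subst (v ∈_) (sym ⋃≡⊤) ∈⊤)
  where ⋃≡⊤ = ∣p∣≡n⇒p≡⊤ (trans (∣⋃∣≡t*r E disjoint size) (sym n≡t*r))

++-injective : ∀ {a ℓ} {A : Set a} {_≈_ : Rel A ℓ} {m n} (xs : Vector A m) (ys : Vector A n) →
  Symmetric _≈_ → Injective _≡_ _≈_ xs → Injective _≡_ _≈_ ys → (∀ i j → ¬ xs i ≈ ys j) →
  Injective _≡_ _≈_ (xs ++ ys)
++-injective {m = m} xs ys sym≈ xs-inj ys-inj apart {i} {j} same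
  with splitAt m i in splitAt-i | splitAt m j in splitAt-j
... | inj₁ a | inj₁ b =
  trans (sym (Fin.splitAt⁻¹-↑ˡ splitAt-i)) (trans (cong (_↑ˡ _) (xs-inj same)) (Fin.splitAt⁻¹-↑ˡ splitAt-j))
... | inj₁ a | inj₂ b = contradiction same (apart a b)
... | inj₂ a | inj₁ b = contradiction (sym≈ same) (apart b a)
... | inj₂ a | inj₂ b =
  trans (sym (Fin.splitAt⁻¹-↑ʳ splitAt-i)) (trans (cong (m ↑ʳ_) (ys-inj same)) (Fin.splitAt⁻¹-↑ʳ splitAt-j))

-- How one matching treats a pair of vertices: split between the special edges 0 and 1 (in
-- one of two orientations), or contained in the edge of colour j + 2.
data PairState (t' : ℕ) : Set where
  split : Bool → PairState t'
  full  : Fin t' → PairState t'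

special : ∀ {t'} → Bool → Fin (2 + t')
special false = zero
special true  = suc zero

special-injective : ∀ {t'} {γ γ'} → special {t'} γ ≡ special γ' → γ ≡ γ'
special-injective {γ = false} {false} _ = refl
special-injective {γ = true}  {true}  _ = refl

halfColour : ∀ {t'} → PairState t' → Bool → Fin (2 + t')
halfColour (split β) β' = special (β xor β')
halfColour (full j)  _  = suc (suc j)

shape : ∀ {t'} → PairState t' → Maybe Bool
shape (split β) = just β
shape (full _)  = nothing

xor-cancelˡ : ∀ x y → x xor (x xor y) ≡ y
xor-cancelˡ false y = refl
xor-cancelˡ true  y = not-involutive y

xor-cancel : ∀ x y z → x xor (y xor z) ≡ z → x ≡ y
xor-cancel false false z _  = refl
xor-cancel true  true  z _  = refl
xor-cancel false true  z eq = contradiction (sym eq) (not-¬ refl)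
xor-cancel true  false z eq = contradiction (sym eq) (not-¬ refl)

pairWeight : ∀ {t'} → PairState t' → Fin (2 + t') → ℕ
pairWeight ℓ c = δ (halfColour ℓ false) c + δ (halfColour ℓ true) c

-- The colour counts of the pairs of a pattern with k split pairs whose full pairs are coloured by s.
profile : ∀ {t' U} → ℕ → (Fin U → Fin t') → Fin (2 + t') → ℕ
profile k s zero          = k
profile k s (suc zero)    = k
profile k s (suc (suc j)) = colourCount s j + colourCount s j

pairWeight-split : ∀ {t' U} k (s : Fin U → Fin t') β c →
  pairWeight (split β) c + profile k s c ≡ profile (suc k) s c
pairWeight-split k s false zero          = refl
pairWeight-split k s false (suc zero)    = refl
pairWeight-split k s false (suc (suc j)) = refl
pairWeight-split k s true  zero          = refl
pairWeight-split k s true  (suc zero)    = refl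
pairWeight-split k s true  (suc (suc j)) = refl

pairWeight-full : ∀ {t' U} k (s : Fin (suc U) → Fin t') c →
  pairWeight (full (s zero)) c + profile k (s ∘′ suc) c ≡ profile k s c
pairWeight-full k s zero          = refl
pairWeight-full k s (suc zero)    = refl
pairWeight-full k s (suc (suc j)) = interchange (δ (s zero) j) _ (colourCount (s ∘′ suc) j) _

arrangements : ℕ → ℕ → ℕ
arrangements zero    U       = 1
arrangements (suc k) zero    = arrangements k zero + arrangements k zero
arrangements (suc k) (suc U) = arrangements (suc k) U + (arrangements k (suc U) + arrangements k (suc U))

arrangements[k,0]≡2^k : ∀ k → arrangements k 0 ≡ 2 ^ k
arrangements[k,0]≡2^k zero    = refl
arrangements[k,0]≡2^k (suc k) =
  trans (cong (λ a → a + a) (arrangements[k,0]≡2^k k)) (cong (2 ^ k +_) (sym (+-identityʳ (2 ^ k))))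

arrangements≡ : ∀ k U → arrangements k U ≡ ((k + U) C k) * 2 ^ k
arrangements≡ zero    U    = refl
arrangements≡ (suc k) zero = begin
  arrangements (suc k) 0                ≡⟨ arrangements[k,0]≡2^k (suc k) ⟩
  2 ^ suc k                             ≡⟨ *-identityˡ (2 ^ suc k) ⟨
  1 * 2 ^ suc k                         ≡⟨ cong (_* 2 ^ suc k) (trans (cong (_C suc k) (+-identityʳ (suc k))) (nCn≡1 (suc k))) ⟨
  ((suc k + 0) C suc k) * 2 ^ suc k     ∎
  where open ≡-Reasoning
arrangements≡ (suc k) (suc U) = begin
  arrangements (suc k) U + (arrangements k (suc U) + arrangements k (suc U))
    ≡⟨ cong₂ (λ a b → a + (b + b)) (arrangements≡ (suc k) U) (arrangements≡ k (suc U)) ⟩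
  (suc (k + U) C suc k) * 2 ^ suc k + ((n C k) * 2 ^ k + (n C k) * 2 ^ k)
    ≡⟨ cong (λ m → (m C suc k) * 2 ^ suc k + ((n C k) * 2 ^ k + (n C k) * 2 ^ k)) (sym (+-suc k U)) ⟩
  (n C suc k) * 2 ^ suc k + ((n C k) * 2 ^ k + (n C k) * 2 ^ k)
    ≡⟨ solve 3 (λ a b p → b :* (con 2 :* p) :+ (a :* p :+ a :* p) := (a :+ b) :* (con 2 :* p)) refl
               (n C k) (n C suc k) (2 ^ k) ⟩
  ((n C k) + (n C suc k)) * 2 ^ suc k
    ≡⟨ cong (_* 2 ^ suc k) (nCk+nC[k+1]≡[n+1]C[k+1] n k) ⟩
  (suc n C suc k) * 2 ^ suc k ∎
  where
  n = k + suc U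
  open ≡-Reasoning
  open +-*-Solver

module _ {t' : ℕ} where

  Pattern : ℕ → Set
  Pattern P = Vector (PairState t') P

  fullFirst : ∀ {a P} → Fin t' → Vector (Pattern P) a → Vector (Pattern (suc P)) a
  fullFirst j πs = map (full j ∷_) πs

  splitFirst : ∀ {a P} → Vector (Pattern P) a → Vector (Pattern (suc P)) (a + a)
  splitFirst πs = map (split true ∷_) πs ++ map (split false ∷_) πs

  -- All patterns of P = k + U pairs with exactly k split pairs in which the u-th full pair,
  -- counted from the left, has colour s u + 2.
  arrangement : ∀ P k U → k + U ≡ P → (Fin U → Fin t') → Vector (Pattern P) (arrangements k U)
  arrangement zero    zero    zero    _  s _ = λ ()
  arrangement (suc P) zero    (suc U) eq s   = fullFirst (s zero) (arrangement P zero U (suc-injective eq) (s ∘′ suc))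
  arrangement (suc P) (suc k) zero    eq s   = splitFirst (arrangement P k zero (suc-injective eq) s)
  arrangement (suc P) (suc k) (suc U) eq s   =
    fullFirst (s zero) (arrangement P (suc k) U (trans (sym (+-suc k U)) (suc-injective eq)) (s ∘′ suc))
    ++ splitFirst (arrangement P k (suc U) (suc-injective eq) s)

  ∑-pairWeight : ∀ {P} → Pattern P → Fin (2 + t') → ℕ
  ∑-pairWeight π c = sum (λ p → pairWeight (π p) c)

  HasProfile : ∀ {P U} → ℕ → (Fin U → Fin t') → Pattern P → Set
  HasProfile k s π = ∀ c → ∑-pairWeight π c ≡ profile k s c

  split∷-hasProfile : ∀ {P U k} {s : Fin U → Fin t'} β (π : Pattern P) →
    HasProfile k s π → HasProfile (suc k) s (split β ∷ π)
  split∷-hasProfile {k = k} {s} β π hp c = trans (cong (pairWeight (split β) c +_) (hp c)) (pairWeight-split k s β c)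

  fullFirst-hasProfile : ∀ {a P U k} {s : Fin (suc U) → Fin t'} (πs : Vector (Pattern P) a) →
    All (HasProfile k (s ∘′ suc)) πs → All (HasProfile k s) (fullFirst (s zero) πs)
  fullFirst-hasProfile {k = k} {s} πs hps i c =
    trans (cong (pairWeight (full (s zero)) c +_) (hps i c)) (pairWeight-full k s c)

  splitFirst-hasProfile : ∀ {a P U k} {s : Fin U → Fin t'} (πs : Vector (Pattern P) a) →
    All (HasProfile k s) πs → All (HasProfile (suc k) s) (splitFirst πs)
  splitFirst-hasProfile {k = k} {s} πs hps = All.++⁺ (HasProfile (suc k) s)
    (λ i → split∷-hasProfile true (πs i) (hps i)) (λ i → split∷-hasProfile false (πs i) (hps i))

  arrangement-hasProfile : ∀ P k U eq (s : Fin U → Fin t') → All (HasProfile k s) (arrangement P k U eq s)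
  arrangement-hasProfile zero    zero    zero    _  s _ zero          = refl
  arrangement-hasProfile zero    zero    zero    _  s _ (suc zero)    = refl
  arrangement-hasProfile zero    zero    zero    _  s _ (suc (suc j)) = refl
  arrangement-hasProfile (suc P) zero    (suc U) eq s =
    fullFirst-hasProfile (arrangement P zero U _ (s ∘′ suc)) (arrangement-hasProfile P zero U _ (s ∘′ suc))
  arrangement-hasProfile (suc P) (suc k) zero    eq s =
    splitFirst-hasProfile (arrangement P k zero _ s) (arrangement-hasProfile P k zero _ s)
  arrangement-hasProfile (suc P) (suc k) (suc U) eq s = All.++⁺ (HasProfile (suc k) s)
    (fullFirst-hasProfile (arrangement P (suc k) U _ (s ∘′ suc)) (arrangement-hasProfile P (suc k) U _ (s ∘′ suc)))
    (splitFirst-hasProfile (arrangement P k (suc U) _ s) (arrangement-hasProfile P k (suc U) _ s))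

  SameShape : ∀ {P} → Pattern P → Pattern P → Set
  SameShape π π' = ∀ p → shape (π p) ≡ shape (π' p)

  sameShape-sym : ∀ {P} → Symmetric (SameShape {P})
  sameShape-sym same p = sym (same p)

  ShapeInjective : ∀ {a P} → Vector (Pattern P) a → Set
  ShapeInjective πs = Injective _≡_ SameShape πs

  ∷-shapeInjective : ∀ {a P} ℓ (πs : Vector (Pattern P) a) →
    ShapeInjective πs → ShapeInjective (map (ℓ ∷_) πs)
  ∷-shapeInjective ℓ πs inj same = inj (same ∘ suc)

  splitFirst-shapeInjective : ∀ {a P} (πs : Vector (Pattern P) a) →
    ShapeInjective πs → ShapeInjective (splitFirst πs)
  splitFirst-shapeInjective πs inj = ++-injective {_≈_ = SameShape} _ _ sameShape-sym
    (∷-shapeInjective (split true) πs inj) (∷-shapeInjective (split false) πs inj)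
    (λ _ _ same → case same zero of λ ())

  splitFirst-startsSplit : ∀ {a P} (πs : Vector (Pattern P) a) i → ∃ λ β → splitFirst πs i zero ≡ split β
  splitFirst-startsSplit {a} πs i with splitAt a i
  ... | inj₁ _ = true , refl
  ... | inj₂ _ = false , refl

  arrangement-shapeInjective : ∀ P k U eq (s : Fin U → Fin t') → ShapeInjective (arrangement P k U eq s)
  arrangement-shapeInjective zero    zero    zero    _  s {zero} {zero} _ = refl
  arrangement-shapeInjective (suc P) zero    (suc U) eq s =
    ∷-shapeInjective (full (s zero)) (arrangement P zero U _ (s ∘′ suc))
      (arrangement-shapeInjective P zero U _ (s ∘′ suc))
  arrangement-shapeInjective (suc P) (suc k) zero    eq s =
    splitFirst-shapeInjective (arrangement P k zero _ s) (arrangement-shapeInjective P k zero _ s)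
  arrangement-shapeInjective (suc P) (suc k) (suc U) eq s =
    ++-injective {_≈_ = SameShape} (fullFirst (s zero) πsᶠ) (splitFirst πsˢ) sameShape-sym
      (∷-shapeInjective (full (s zero)) πsᶠ (arrangement-shapeInjective P (suc k) U _ (s ∘′ suc)))
      (splitFirst-shapeInjective πsˢ (arrangement-shapeInjective P k (suc U) _ s))
      (λ _ j same → case trans (same zero) (cong shape (proj₂ (splitFirst-startsSplit πsˢ j))) of λ ())
    where
    πsᶠ = arrangement P (suc k) U (trans (sym (+-suc k U)) (suc-injective eq)) (s ∘′ suc)
    πsˢ = arrangement P k (suc U) (suc-injective eq) s

-- Vertices: t * e padding vertices, e of each colour, followed by the two halves of each of
-- the Q = 1 + P pairs.  Pair 0 is split the same way in every matching, so its halves are the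
-- special vertices, of colours 0 and 1 throughout.
module Construction (t' e k h : ℕ) (k+1≡h+h : suc k ≡ h + h) where

  t r U P Q n N : ℕ
  t = 2 + t'
  r = e + (h + h)
  U = t' * h
  P = k + U
  Q = suc P
  n = t * e + (Q + Q)
  N = arrangements k U

  padding : Fin (t * e) → Fin t
  padding = quotient e

  fullColour : Fin U → Fin t'
  fullColour = quotient h

  pairing : Fin N → Pattern Q
  pairing i = split false ∷ arrangement P k U refl fullColour i

  halfColouring : Fin N → Bool → Fin Q → Fin t
  halfColouring i β p = halfColour (pairing i p) β

  halves : Fin N → Fin (Q + Q) → Fin t
  halves i = halfColouring i false ++ halfColouring i true

  colouring : Fin N → Fin n → Fin t
  colouring i = padding ++ halves i

  half : Bool → Fin Q → Fin n
  half false p = t * e ↑ʳ (p ↑ˡ Q)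
  half true  p = t * e ↑ʳ (Q ↑ʳ p)

  colouring-half : ∀ i β p → colouring i (half β p) ≡ halfColour (pairing i p) β
  colouring-half i false p =
    trans (lookup-++ʳ padding (halves i) (p ↑ˡ Q)) (lookup-++ˡ (halfColouring i false) (halfColouring i true) p)
  colouring-half i true  p =
    trans (lookup-++ʳ padding (halves i) (Q ↑ʳ p)) (lookup-++ʳ {m = Q} (halfColouring i false) (halfColouring i true) p)

  colouring-half≡ : ∀ {i ℓ} β p → pairing i p ≡ ℓ → colouring i (half β p) ≡ halfColour ℓ β
  colouring-half≡ {i} β p eq = trans (colouring-half i β p) (cong (λ ℓ → halfColour ℓ β) eq)

  colourCount-halves : ∀ i c → colourCount (halves i) c ≡ ∑-pairWeight (pairing i) c
  colourCount-halves i c = trans (colourCount-++ (halfColouring i false) (halfColouring i true) c)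
    (sym (∑-distrib-+ (λ p → δ (halfColouring i false p) c) (λ p → δ (halfColouring i true p) c)))

  pairing-hasProfile : ∀ i → HasProfile (suc k) fullColour (pairing i)
  pairing-hasProfile i =
    split∷-hasProfile false (arrangement P k U refl fullColour i) (arrangement-hasProfile P k U refl fullColour i)

  profile-balanced : ∀ c → profile (suc k) fullColour c ≡ h + h
  profile-balanced zero          = k+1≡h+h
  profile-balanced (suc zero)    = k+1≡h+h
  profile-balanced (suc (suc j)) = cong (λ x → x + x) (colourCount-quotient t' h j)

  colourCount-colouring : ∀ i c → colourCount (colouring i) c ≡ r
  colourCount-colouring i c = begin
    colourCount (colouring i) c                         ≡⟨ colourCount-++ padding (halves i) c ⟩
    colourCount padding c + colourCount (halves i) c    ≡⟨ cong₂ _+_ (colourCount-quotient t e c) (colourCount-halves i c) ⟩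
    e + ∑-pairWeight (pairing i) c                      ≡⟨ cong (e +_) (pairing-hasProfile i c) ⟩
    e + profile (suc k) fullColour c                    ≡⟨ cong (e +_) (profile-balanced c) ⟩
    r                                                   ∎
    where open ≡-Reasoning

  t*[h+h]≡2+[P+P] : t * (h + h) ≡ 2 + (P + P)
  t*[h+h]≡2+[P+P] = begin
    t * (h + h)              ≡⟨ solve 2 (λ t' h → (con 2 :+ t') :* (h :+ h) := h :+ h :+ (h :+ h) :+ (t' :* h :+ t' :* h))
                                        refl t' h ⟩
    h + h + (h + h) + (U + U) ≡⟨ cong (λ x → x + x + (U + U)) k+1≡h+h ⟨
    suc k + suc k + (U + U)   ≡⟨ solve 2 (λ k U → con 1 :+ k :+ (con 1 :+ k) :+ (U :+ U) := con 2 :+ (k :+ U :+ (k :+ U)))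
                                        refl k U ⟩
    2 + (P + P)               ∎
    where open ≡-Reasoning
          open +-*-Solver

  n≡t*r : n ≡ t * r
  n≡t*r = begin
    t * e + (suc P + suc P)   ≡⟨ cong (λ x → t * e + suc x) (+-suc P P) ⟩
    t * e + (2 + (P + P))     ≡⟨ cong (t * e +_) t*[h+h]≡2+[P+P] ⟨
    t * e + t * (h + h)       ≡⟨ *-distribˡ-+ t e (h + h) ⟨
    t * r                     ∎
    where open ≡-Reasoning

  matchings : Fin N → Fin t → Subset n
  matchings i = colourClass (colouring i)

  matchings-isMatching : ∀ i → IsMatching r t (matchings i)
  matchings-isMatching i = colourClass-isMatching (colouring i) (colourCount-colouring i)

  module _ (σ : Fin t → Fin N) (cc : Fin t → Fin t)
           (disjoint : PairwiseDisjoint (λ d → matchings (σ d) (cc d))) where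

    Covers : Fin t → Fin n → Set
    Covers d v = colouring (σ d) v ≡ cc d

    covered : ∀ v → ∃ λ d → Covers d v
    covered v = Product.map₂ (λ {d} → ∈-colourClass⁻ (colouring (σ d)))
      (⋃-covers (λ d → matchings (σ d) (cc d)) disjoint (λ d → proj₁ (matchings-isMatching (σ d)) (cc d)) n≡t*r v)

    covers-unique : ∀ {d d' v} → Covers d v → Covers d' v → d ≡ d'
    covers-unique {d} {d'} {v} d∋v d'∋v with d ≟ d'
    ... | yes d≡d' = d≡d'
    ... | no  d≢d' = contradiction (v , x∈p∩q⁺ (d∋v′ , d'∋v′)) (disjoint d d' d≢d')
      where
      d∋v′  = ∈-colourClass⁺ (colouring (σ d)) d∋v
      d'∋v′ = ∈-colourClass⁺ (colouring (σ d')) d'∋v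

    owner : Bool → Fin t
    owner γ = proj₁ (covered (half γ zero))

    owner-colour : ∀ γ → cc (owner γ) ≡ special γ
    owner-colour γ = trans (sym (proj₂ (covered (half γ zero)))) (colouring-half _ γ zero)

    owner-unique : ∀ γ {d v} → Covers d v → colouring (σ d) v ≡ special γ → d ≡ owner γ
    owner-unique γ d∋v colour≡ =
      covers-unique (trans (colouring-half _ γ zero) (trans (sym colour≡) d∋v)) (proj₂ (covered (half γ zero)))

    -- The owner of γ splits p as β; the half of p it misses, coloured special (not γ), is
    -- covered by some d.  A full pair at d would put the other half into d as well, so d is
    -- split at p, hence owns not γ, and the colour of that half forces the orientation β.
    module _ (γ β : Bool) (p : Fin Q) (owner-splits : pairing (σ (owner γ)) p ≡ split β) where

      owner-colours : ∀ β' → colouring (σ (owner γ)) (half (β xor β') p) ≡ special β'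
      owner-colours β' = trans (colouring-half≡ (β xor β') p owner-splits) (cong special (xor-cancelˡ β β'))

      owner∌other : ¬ Covers (owner γ) (half (β xor not γ) p)
      owner∌other owner∋ =
        not-¬ refl (sym (special-injective (trans (sym (owner-colours (not γ))) (trans owner∋ (owner-colour γ)))))

      owner∋own : Covers (owner γ) (half (β xor γ) p)
      owner∋own = trans (owner-colours γ) (sym (owner-colour γ))

      transfer : ∀ {d} ℓ → Covers d (half (β xor not γ) p) → pairing (σ d) p ≡ ℓ →
        pairing (σ (owner (not γ))) p ≡ split β
      transfer {d} (full j) d∋other d-pairs = contradiction (subst (λ x → Covers x _) d≡owner d∋other) owner∌other
        where
        d∋own : Covers d (half (β xor γ) p)
        d∋own = trans (colouring-half≡ (β xor γ) p d-pairs)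
                      (trans (sym (colouring-half≡ (β xor not γ) p d-pairs)) d∋other)
        d≡owner : d ≡ owner γ
        d≡owner = covers-unique d∋own owner∋own
      transfer {d} (split β') d∋other d-pairs = begin
        pairing (σ (owner (not γ))) p  ≡⟨ cong (λ x → pairing (σ (owner x)) p) γ'≡not-γ ⟨
        pairing (σ (owner γ')) p       ≡⟨ cong (λ x → pairing (σ x) p) d≡owner ⟨
        pairing (σ d) p                ≡⟨ d-pairs ⟩
        split β'                       ≡⟨ cong split (xor-cancel β' β (not γ) γ'≡not-γ) ⟩
        split β                        ∎
        where
        open ≡-Reasoning
        γ' = β' xor (β xor not γ)
        d≡owner : d ≡ owner γ'
        d≡owner = owner-unique γ' d∋other (colouring-half≡ (β xor not γ) p d-pairs)
        γ'≡not-γ : γ' ≡ not γ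
        γ'≡not-γ = ¬-not λ γ'≡γ →
          owner∌other (subst (λ x → Covers x _) (trans d≡owner (cong owner γ'≡γ)) d∋other)

      split-transfers : pairing (σ (owner (not γ))) p ≡ split β
      split-transfers = transfer _ (proj₂ (covered (half (β xor not γ) p))) refl

    owners-sameShape : SameShape (pairing (σ (owner false))) (pairing (σ (owner true)))
    owners-sameShape p = sameShape _ _ refl refl
      where
      sameShape : ∀ ℓ₀ ℓ₁ → pairing (σ (owner false)) p ≡ ℓ₀ → pairing (σ (owner true)) p ≡ ℓ₁ →
        shape ℓ₀ ≡ shape ℓ₁
      sameShape (split β) _         pairs₀ pairs₁ = cong shape (trans (sym (split-transfers false β p pairs₀)) pairs₁)
      sameShape (full j)  (split β) pairs₀ pairs₁ = case trans (sym pairs₀) (split-transfers true β p pairs₁) of λ ()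
      sameShape (full j)  (full j') _      _      = refl

    owners-equal : (∀ {i j} → σ i ≡ σ j → i ≡ j) → owner false ≡ owner true
    owners-equal σ-injective =
      σ-injective (arrangement-shapeInjective P k U refl fullColour (owners-sameShape ∘ suc))

  noRainbow : ¬ HasRainbowMatching t matchings
  noRainbow (σ , σ-injective , cc , disjoint) = case special-injective special-false≡true of λ ()
    where
    special-false≡true : special false ≡ special true
    special-false≡true = trans (sym (owner-colour σ cc disjoint false))
      (trans (cong cc (owners-equal σ cc disjoint σ-injective)) (owner-colour σ cc disjoint true))

  F≥-construction : F≥ r t N
  F≥-construction = n , matchings , matchings-isMatching , noRainbow

x+x/2≡x : ∀ x → (x + x) / 2 ≡ x
x+x/2≡x x = trans (cong (_/ 2) (solve 1 (λ x → x :+ x := x :* con 2) refl x)) (m*n/n≡m x 2)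
  where open +-*-Solver

r≡r%2+[r/2+r/2] : ∀ r → r ≡ r % 2 + (r / 2 + r / 2)
r≡r%2+[r/2+r/2] r = trans (m≡m%n+[m/n]*n r 2) (cong (r % 2 +_) (solve 1 (λ x → x :* con 2 := x :+ x) refl (r / 2)))
  where open +-*-Solver

evenBound oddBound : ℕ → ℕ → ℕ
evenBound t r = ((((t * r) ∸ 2) / 2) C (r ∸ 1)) * 2 ^ (r ∸ 1)
oddBound  t r = ((((t * r) ∸ t ∸ 2) / 2) C (r ∸ 2)) * 2 ^ (r ∸ 2)

F≥-even : ∀ t' q → 2 ≤ q + q → F≥ (q + q) (2 + t') (evenBound (2 + t') (q + q))
F≥-even t' zero    ()
F≥-even t' (suc q') _ = subst (F≥ r t) N≡bound F≥-construction
  where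
  k h : ℕ
  k = q' + suc q'
  h = suc q'
  open Construction t' 0 k h refl
  N≡bound : N ≡ evenBound t r
  N≡bound = trans (arrangements≡ k U) (cong (λ x → (x C k) * 2 ^ k) (sym (begin
    (t * (h + h) ∸ 2) / 2  ≡⟨ cong (λ x → (x ∸ 2) / 2) t*[h+h]≡2+[P+P] ⟩
    (P + P) / 2            ≡⟨ x+x/2≡x P ⟩
    P                      ∎)))
    where open ≡-Reasoning

F≥-odd : ∀ t' q → 3 ≤ 1 + (q + q) → F≥ (1 + (q + q)) (2 + t') (oddBound (2 + t') (1 + (q + q)))
F≥-odd t' zero    (s≤s ())
F≥-odd t' (suc q') _ = subst (F≥ r t) N≡bound F≥-construction
  where
  k h : ℕ
  k = q' + suc q'
  h = suc q'
  open Construction t' 1 k h refl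
  N≡bound : N ≡ oddBound t r
  N≡bound = trans (arrangements≡ k U) (cong (λ x → (x C k) * 2 ^ k) (sym (begin
    (t * suc (h + h) ∸ t ∸ 2) / 2  ≡⟨ cong (λ x → (x ∸ t ∸ 2) / 2) (*-suc t (h + h)) ⟩
    (t + t * (h + h) ∸ t ∸ 2) / 2  ≡⟨ cong (λ x → (x ∸ 2) / 2) (m+n∸m≡n t (t * (h + h))) ⟩
    (t * (h + h) ∸ 2) / 2          ≡⟨ cong (λ x → (x ∸ 2) / 2) t*[h+h]≡2+[P+P] ⟩
    (P + P) / 2                    ≡⟨ x+x/2≡x P ⟩
    P                              ∎)))
    where open ≡-Reasoning

theorem4p18 : (t : ℕ) → 2 ≤ t →
    ((r : ℕ) → 2 ≤ r → r % 2 ≡ 0 → F≥ r t (((((t * r) ∸ 2) / 2) C (r ∸ 1)) * 2 ^ (r ∸ 1)))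
    × ((r : ℕ) → 3 ≤ r → r % 2 ≡ 1 → F≥ r t (((((t * r) ∸ t ∸ 2) / 2) C (r ∸ 2)) * 2 ^ (r ∸ 2)))
theorem4p18 (suc (suc t')) (s≤s (s≤s z≤n)) = even , odd
  where
  even : ∀ r → 2 ≤ r → r % 2 ≡ 0 → F≥ r (2 + t') (evenBound (2 + t') r)
  even r 2≤r r%2≡0 = subst (λ r → F≥ r (2 + t') (evenBound (2 + t') r)) (sym r≡q+q)
                       (F≥-even t' (r / 2) (subst (2 ≤_) r≡q+q 2≤r))
    where r≡q+q = trans (r≡r%2+[r/2+r/2] r) (cong (_+ (r / 2 + r / 2)) r%2≡0)
  odd : ∀ r → 3 ≤ r → r % 2 ≡ 1 → F≥ r (2 + t') (oddBound (2 + t') r)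
  odd r 3≤r r%2≡1 = subst (λ r → F≥ r (2 + t') (oddBound (2 + t') r)) (sym r≡1+q+q)
                      (F≥-odd t' (r / 2) (subst (3 ≤_) r≡1+q+q 3≤r))
    where r≡1+q+q = trans (r≡r%2+[r/2+r/2] r) (cong (_+ (r / 2 + r / 2)) r%2≡1)
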